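{- Let $G$ be a vertex-transitive graph and $H$ an arbitrary graph. Let $T$ be a graph obtained from $G$ by adding some new edges, such that $\alpha(T^c\boxtimes H)=\alpha(G^c\boxtimes H)$. Then $$\alpha^*(T|H)=\alpha^*(G|H)=\frac{|\mathcal V(T)|}{\alpha(T^c\boxtimes H)}.$$
   Context: All graphs are finite, simple, undirected; $G^c$ is the complement, $\boxtimes$ the strong product, $\alpha$ the independence number, and $\alpha^*(A|B)=\sup_W\frac{\alpha(A\boxtimes W)}{\alpha(B\boxtimes W)}$ over all graphs $W$. Vertex-transitive means the automorphism group acts transitively on vertices. -}

module Defs where

open import Data.Nat using (ℕ; zero; suc; _⊔_; _*_)
open import Data.Bool using (Bool; true; false; not; _∧_; _∨_; if_then_else_)
open import Data.Fin using (Fin; remQuot; _≟_)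
open import Data.Fin.Subset using (Subset; inside; outside; ∣_∣; _∈_)
open import Data.Vec using (Vec; []; _∷_; lookup)
open import Data.List using (List; []; _∷_; map; _++_; foldr; allFin)
open import Data.Bool.ListAction using (and)
open import Data.Product using (Σ; ∃; ∃-syntax; _×_; _,_; proj₁; proj₂)
open import Data.Rational using (ℚ; normalize; 0ℚ; _≤_; _<_)
open import Relation.Nullary.Decidable using (⌊_⌋)
open import Relation.Binary.PropositionalEquality using (_≡_)

Adj : ℕ → Set
Adj n = Fin n → Fin n → Bool

record Graph (n : ℕ) : Set where
  field
    adj    : Adj n
    sym    : ∀ i j → adj i j ≡ adj j i
    irrefl : ∀ i → adj i i ≡ false
open Graph public

_==_ : ∀ {n} → Fin n → Fin n → Bool
i == j = ⌊ i ≟ j ⌋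

compl : ∀ {n} → Adj n → Adj n
compl a i j = not (a i j) ∧ not (i == j)

-- strong product on Fin (m * k), vertex (i , j) encoded via combine/remQuot
strong : ∀ {m k} → Adj m → Adj k → Adj (m * k)
strong {m} {k} a b x y =
  let (i , j) = remQuot {m} k x
      (i' , j') = remQuot {m} k y
  in not (x == y) ∧ ((i == i') ∨ a i i') ∧ ((j == j') ∨ b j j')

mem : ∀ {n} → Fin n → Subset n → Bool
mem i s with lookup s i
... | inside = true
... | outside = false

independent : ∀ {n} → Adj n → Subset n → Bool
independent {n} a s =
  and (map (λ i → and (map (λ j → not (mem i s ∧ mem j s ∧ a i j)) (allFin n))) (allFin n))

subsets : (n : ℕ) → List (Subset n)
subsets zero = [] ∷ []
subsets (suc n) = map (inside ∷_) (subsets n) ++ map (outside ∷_) (subsets n)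

α : ∀ {n} → Adj n → ℕ
α {n} a = foldr _⊔_ 0 (map (λ s → if independent a s then ∣ s ∣ else 0) (subsets n))

-- a / b as a rational (convention: 0 when b = 0; never used in that case)
ratio : ℕ → ℕ → ℚ
ratio a zero = 0ℚ
ratio a (suc b) = normalize a (suc b)

-- IsAlphaStar A B r :  r = sup_W α(A ⊠ W) / α(B ⊠ W),  W ranging over all
-- nonempty finite simple graphs; the sup is expressed as least upper bound.
IsAlphaStar : ∀ {n k} → Graph n → Graph k → ℚ → Set
IsAlphaStar A B r =
  (∀ m (W : Graph (suc m)) →
     ratio (α (strong (adj A) (adj W))) (α (strong (adj B) (adj W))) ≤ r)
  × (∀ q → q < r → ∃[ m ] Σ (Graph (suc m)) λ W →
     q < ratio (α (strong (adj A) (adj W))) (α (strong (adj B) (adj W))))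

IsAutomorphism : ∀ {n} → Graph n → (Fin n → Fin n) → Set
IsAutomorphism {n} G f =
  Σ (Fin n → Fin n) λ g → (∀ x → g (f x) ≡ x) × (∀ x → f (g x) ≡ x)
    × (∀ x y → adj G (f x) (f y) ≡ adj G x y)

VertexTransitive : ∀ {n} → Graph n → Set
VertexTransitive {n} G = ∀ (u v : Fin n) → Σ (Fin n → Fin n) λ f → IsAutomorphism G f × f u ≡ v

Supergraph : ∀ {n} → Graph n → Graph n → Set
Supergraph {n} T G = ∀ (i j : Fin n) → adj G i j ≡ true → adj T i j ≡ true

-- Let S and I be independent sets of G ⊠ W and Gᶜ ⊠ H. For an automorphism σ of G, the pairs (y , x)
-- with (σ a , y) ∈ I and (a , x) ∈ S for some a form an independent set of H ⊠ W, each arising from a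
-- single a: distinct a, a' are adjacent either in G, or else their images are adjacent in Gᶜ. Its size
-- is ∑ₐ ∣I_{σ a}∣ ∣S_a∣, and averaging over the automorphisms, which move a to every vertex equally
-- often when G is vertex-transitive, turns this into ∣S∣ ∣I∣ / ∣V(G)∣. So
-- α(G ⊠ W) α(Gᶜ ⊠ H) ≤ ∣V(G)∣ α(H ⊠ W), and adding edges to G only decreases α(G ⊠ W); together with
-- α(Tᶜ ⊠ H) = α(Gᶜ ⊠ H) this bounds both ratios by ∣V(G)∣ / α(Tᶜ ⊠ H). The bound is attained at
-- W = Xᶜ for X = T, G: the diagonal is independent in X ⊠ Xᶜ, and α(H ⊠ Xᶜ) = α(Xᶜ ⊠ H).

module Submission where

open import Defs hiding (sym)
open import Data.Nat using (ℕ; zero; suc; _+_; _*_; _^_; _⊔_; _≤_; z≤n; s≤s; _<ᵇ_; >-nonZero)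
open import Data.Nat.Properties
  using ( +-*-semiring; *-commutativeSemigroup; +-assoc; +-identityʳ; *-identityʳ; *-assoc; *-comm
        ; +-mono-≤; *-mono-≤; *-monoˡ-≤; *-monoʳ-≤; *-cancelˡ-≤; m≤m+n; m≤n+m; ≤-refl; ≤-reflexive; ≤-trans
        ; ⊔-sel; m≤n⇒m≤n⊔o; m≤n⇒m≤o⊔n; <ᵇ⇒<; module ≤-Reasoning )
open import Data.Bool using (Bool; true; false; not; _∧_; _∨_; T; if_then_else_)
open import Data.Bool.Properties using (T-≡; ∨-zeroʳ; ∧-zeroʳ; ¬-not)
import Data.Bool.Properties as Bool
open import Data.Bool.ListAction using (and)
open import Data.Fin using (Fin; zero; suc; _↑ˡ_; _↑ʳ_; combine; remQuot; finToFun; funToFin)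
open import Data.Fin.Properties
  using ( _≟_; suc-injective; all?; remQuot-combine; combine-remQuot; combine-injective
        ; finToFun-funToFin; funToFin-finToFin )
open import Data.Fin.Permutation using (Permutation′; permutation)
open import Data.Fin.Subset using (Subset; ∣_∣; ⊥; ⁅_⁆)
open import Data.Fin.Subset.Properties using (∣⊥∣≡0; ∣⁅x⁆∣≡1)
open import Data.Vec using ([]; _∷_; lookup; tabulate)
open import Data.Vec.Properties using (lookup∘tabulate; lookup-replicate)
open import Data.List using (map; allFin)
open import Data.List.Properties using (foldr-preservesᵇ; foldr-preservesᵒ)
open import Data.List.Membership.Propositional using (_∈_)
open import Data.List.Membership.Propositional.Properties using (∈-allFin; ∈-map⁺; ∈-++⁺ˡ; ∈-++⁺ʳ)
open import Data.List.Relation.Unary.Any as Any using (here)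
import Data.List.Relation.Unary.Any.Properties as Any
import Data.List.Relation.Unary.All as All
import Data.List.Relation.Unary.All.Properties as All
open import Data.Product using (Σ; ∃; ∃-syntax; _×_; _,_; proj₁; proj₂; uncurry; swap)
open import Data.Sum using (_⊎_; inj₁; inj₂; [_,_]′)
import Data.Integer as ℤ
open import Data.Integer.Properties using (pos-*)
open import Data.Rational using (toℚᵘ) renaming (_≤_ to _≤ℚ_)
open import Data.Rational.Properties using (toℚᵘ-fromℚᵘ; toℚᵘ-cancel-≤; <-≤-trans)
open import Data.Rational.Unnormalised using (mkℚᵘ; *≤*; _≃_)
open import Data.Rational.Unnormalised.Properties using (≤-respˡ-≃; ≤-respʳ-≃; ≃-sym)
open import Function using (_∘_; flip; id; _⇔_; Equivalence; mk⇔)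
open import Relation.Nullary using (Dec; yes; no; does; ¬_; contradiction)
open import Relation.Nullary.Decidable using (_×-dec_; _→-dec_; does-⇔; dec-true; isYes≗does)
open import Relation.Binary.PropositionalEquality
  using (_≡_; _≢_; _≗_; refl; sym; trans; cong; cong₂; subst; subst₂; module ≡-Reasoning)
open import Algebra.Properties.CommutativeSemigroup *-commutativeSemigroup using (x∙yz≈y∙xz)
open import Algebra.Properties.Semiring.Sum +-*-semiring
  using (sum; sum-syntax; sum-cong-≗; sum-replicate-zero; ∑-comm; ∑-permute; *-distribˡ-sum; *-distribʳ-sum)

-- Finite sums

𝟙 : Bool → ℕ
𝟙 true  = 1
𝟙 false = 0

𝟙-∧ : ∀ u v → 𝟙 (u ∧ v) ≡ 𝟙 u * 𝟙 v
𝟙-∧ false v = refl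
𝟙-∧ true  v = sym (+-identityʳ (𝟙 v))

∧-true : ∀ {u v} → u ∧ v ≡ true → u ≡ true × v ≡ true
∧-true {true} {true} _ = refl , refl

𝟙-0<ᵇ : ∀ c → c ≤ 1 → 𝟙 (0 <ᵇ c) ≡ c
𝟙-0<ᵇ zero          _ = refl
𝟙-0<ᵇ (suc zero)    _ = refl
𝟙-0<ᵇ (suc (suc c)) (s≤s ())

𝟙-does-*-≤ : ∀ {P : Set} (P? : Dec P) {x y} → (P → x ≤ y) → 𝟙 (does P?) * x ≤ 𝟙 (does P?) * y
𝟙-does-*-≤ (yes p) x≤y = +-mono-≤ (x≤y p) z≤n
𝟙-does-*-≤ (no _)  _   = z≤n

∑-mono-≤ : ∀ {n} {f g : Fin n → ℕ} → (∀ i → f i ≤ g i) → sum f ≤ sum g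
∑-mono-≤ {zero}  f≤g = z≤n
∑-mono-≤ {suc n} f≤g = +-mono-≤ (f≤g zero) (∑-mono-≤ (f≤g ∘ suc))

∑-const : ∀ n c → ∑[ i < n ] c ≡ n * c
∑-const zero    c = refl
∑-const (suc n) c = cong (c +_) (∑-const n c)

∑-zero : ∀ {n} (f : Fin n → ℕ) → (∀ i → f i ≡ 0) → sum f ≡ 0
∑-zero {n} f f≡0 = trans (sum-cong-≗ f≡0) (sum-replicate-zero n)

term≤∑ : ∀ {n} (f : Fin n → ℕ) i → f i ≤ sum f
term≤∑ f zero    = m≤m+n (f zero) _
term≤∑ f (suc i) = ≤-trans (term≤∑ (f ∘ suc) i) (m≤n+m _ (f zero))

∑-↑ : ∀ m n (f : Fin (m + n) → ℕ) → sum f ≡ ∑[ i < m ] f (i ↑ˡ n) + ∑[ j < n ] f (m ↑ʳ j)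
∑-↑ zero    n f = refl
∑-↑ (suc m) n f = trans (cong (f zero +_) (∑-↑ m n (f ∘ suc))) (sym (+-assoc (f zero) _ _))

∑-combine : ∀ m n (f : Fin (m * n) → ℕ) → sum f ≡ ∑[ i < m ] ∑[ j < n ] f (combine i j)
∑-combine zero    n f = refl
∑-combine (suc m) n f =
  trans (∑-↑ n (m * n) f) (cong (∑[ j < n ] f (j ↑ˡ (m * n)) +_) (∑-combine m n (f ∘ (n ↑ʳ_))))

∑-δ : ∀ {n} (i : Fin n) (f : Fin n → ℕ) → ∑[ j < n ] (𝟙 (does (i ≟ j)) * f j) ≡ f i
∑-δ {suc n} zero    f = trans (cong (f zero + 0 +_) (∑-zero {n} _ (λ _ → refl))) (trans (+-identityʳ _) (+-identityʳ _))
∑-δ {suc n} (suc i) f = ∑-δ i (f ∘ suc)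

∑-𝟙-≟ : ∀ {n} (i : Fin n) → ∑[ j < n ] 𝟙 (does (i ≟ j)) ≡ 1
∑-𝟙-≟ {suc n} zero    = cong suc (∑-zero {n} _ (λ _ → refl))
∑-𝟙-≟ {suc n} (suc i) = ∑-𝟙-≟ i

∑-𝟙-≤1 : ∀ {n} (Q : Fin n → Bool) → (∀ {a a'} → Q a ≡ true → Q a' ≡ true → a ≡ a') →
  ∑[ a < n ] 𝟙 (Q a) ≤ 1
∑-𝟙-≤1 {zero}  Q unique = z≤n
∑-𝟙-≤1 {suc n} Q unique with Q zero in Q0
... | false = ∑-𝟙-≤1 (Q ∘ suc) (λ p q → suc-injective (unique p q))
... | true  = ≤-reflexive (cong suc (∑-zero _ rest-false))
  where
  rest-false : ∀ a → 𝟙 (Q (suc a)) ≡ 0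
  rest-false a with Q (suc a) in Qa
  ... | false = refl
  ... | true with () ← unique Q0 Qa

∑-𝟙-witness : ∀ {n} (Q : Fin n → Bool) → 1 ≤ ∑[ a < n ] 𝟙 (Q a) → ∃ λ a → Q a ≡ true
∑-𝟙-witness {suc n} Q pos with Q zero in Q0
... | true  = zero , Q0
... | false with ∑-𝟙-witness (Q ∘ suc) pos
...   | a , Qa = suc a , Qa

∑-*-∑ : ∀ {m n} (f : Fin m → ℕ) (g : Fin n → ℕ) → sum f * sum g ≡ ∑[ i < m ] ∑[ j < n ] (f i * g j)
∑-*-∑ f g = trans (*-distribʳ-sum (sum g) f) (sum-cong-≗ λ i → *-distribˡ-sum (f i) g)

∑-*-∑-comm : ∀ {m n} (e : Fin m → ℕ) (f : Fin m → Fin n → ℕ) (g : Fin n → ℕ) →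
  ∑[ i < m ] (e i * ∑[ a < n ] (f i a * g a)) ≡ ∑[ a < n ] (∑[ i < m ] (e i * f i a) * g a)
∑-*-∑-comm {m} {n} e f g = begin
  ∑[ i < m ] (e i * ∑[ a < n ] (f i a * g a))
    ≡⟨ sum-cong-≗ {m} (λ i → *-distribˡ-sum (e i) λ a → f i a * g a) ⟩
  ∑[ i < m ] ∑[ a < n ] (e i * (f i a * g a))
    ≡⟨ ∑-comm (λ i a → e i * (f i a * g a)) ⟩
  ∑[ a < n ] ∑[ i < m ] (e i * (f i a * g a))
    ≡⟨ sum-cong-≗ {n} (λ a → trans (sum-cong-≗ {m} λ i → sym (*-assoc (e i) _ _))
                                   (sym (*-distribʳ-sum (g a) λ i → e i * f i a))) ⟩
  ∑[ a < n ] (∑[ i < m ] (e i * f i a) * g a)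
    ∎
  where open ≡-Reasoning


-- Independent sets

mem≡lookup : ∀ {n} (i : Fin n) (s : Subset n) → mem i s ≡ lookup s i
mem≡lookup i s with lookup s i
... | true  = refl
... | false = refl

∉⊥ : ∀ {n} (i : Fin n) → lookup ⊥ i ≢ true
∉⊥ i i∈⊥ = contradiction (trans (sym (lookup-replicate i false)) i∈⊥) λ ()

Independent : ∀ {n} → Adj n → Subset n → Set
Independent a s = ∀ {i j} → lookup s i ≡ true → lookup s j ≡ true → a i j ≡ false

independent-sound : ∀ {n} (a : Adj n) s → independent a s ≡ true → Independent a s
independent-sound {n} a s indep {i} {j} i∈s j∈s =
  not-∧∧ (lookup s i) (lookup s j) (a i j)
    (subst₂ (λ u v → T (not (u ∧ v ∧ a i j))) (mem≡lookup i s) (mem≡lookup j s) pair-ok)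
    i∈s j∈s
  where
  not-∧∧ : ∀ u v w → T (not (u ∧ v ∧ w)) → u ≡ true → v ≡ true → w ≡ false
  not-∧∧ true true false _ refl refl = refl
  row-ok : T (and (map (λ j → not (mem i s ∧ mem j s ∧ a i j)) (allFin n)))
  row-ok = All.lookup (All.all⁺ _ (allFin n) (Equivalence.from T-≡ indep)) (∈-allFin i)
  pair-ok : T (not (mem i s ∧ mem j s ∧ a i j))
  pair-ok = All.lookup (All.all⁺ _ (allFin n) row-ok) (∈-allFin j)

independent-complete : ∀ {n} (a : Adj n) s → Independent a s → independent a s ≡ true
independent-complete {n} a s indep =
  Equivalence.to T-≡ (All.all⁻ _ (All.universal (λ i → All.all⁻ _ (All.universal (pair-ok i) (allFin n))) (allFin n)))
  where
  pair-ok : ∀ i j → T (not (mem i s ∧ mem j s ∧ a i j))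
  pair-ok i j rewrite mem≡lookup i s | mem≡lookup j s with lookup s i in i∈s | lookup s j in j∈s
  ... | false | _     = _
  ... | true  | false = _
  ... | true  | true  rewrite indep i∈s j∈s = _

subsets-complete : ∀ {n} (s : Subset n) → s ∈ subsets n
subsets-complete []                = here refl
subsets-complete {suc n} (true ∷ s)  = ∈-++⁺ˡ (∈-map⁺ (true ∷_) (subsets-complete s))
subsets-complete {suc n} (false ∷ s) = ∈-++⁺ʳ (map (true ∷_) (subsets n)) (∈-map⁺ (false ∷_) (subsets-complete s))

∣s∣≤α : ∀ {n} (a : Adj n) {s} → Independent a s → ∣ s ∣ ≤ α a
∣s∣≤α {n} a {s} indep = foldr-preservesᵒ {P = ∣ s ∣ ≤_} {f = _⊔_}
  (λ x y → λ { (inj₁ s≤x) → m≤n⇒m≤n⊔o y s≤x ; (inj₂ s≤y) → m≤n⇒m≤o⊔n x s≤y })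
  0 (map size-if-independent (subsets n))
  (inj₂ (Any.map⁺ (Any.map (λ { refl → s≤ }) (subsets-complete s))))
  where
  size-if-independent : Subset n → ℕ
  size-if-independent t = if independent a t then ∣ t ∣ else 0
  s≤ : ∣ s ∣ ≤ size-if-independent s
  s≤ rewrite independent-complete a s indep = ≤-refl

α-attained : ∀ {n} (a : Adj n) → ∃ λ s → Independent a s × ∣ s ∣ ≡ α a
α-attained {n} a = foldr-preservesᵇ {P = Attained} {f = _⊔_}
  (λ {x} {y} px py → [ (λ eq → subst Attained (sym eq) px) , (λ eq → subst Attained (sym eq) py) ]′ (⊔-sel x y))
  empty-attains (All.map⁺ (All.universal attains (subsets n)))
  where
  Attained : ℕ → Set
  Attained v = ∃ λ s → Independent a s × ∣ s ∣ ≡ v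
  empty-attains : Attained 0
  empty-attains = ⊥ , (λ {i} i∈⊥ → contradiction i∈⊥ (∉⊥ i)) , ∣⊥∣≡0 n
  attains : ∀ s → Attained (if independent a s then ∣ s ∣ else 0)
  attains s with independent a s in indep
  ... | true  = s , independent-sound a s indep , refl
  ... | false = empty-attains

1≤α : ∀ {n} (a : Adj (suc n)) → a zero zero ≡ false → 1 ≤ α a
1≤α {n} a loopless = subst (_≤ α a) (∣⁅x⁆∣≡1 {suc n} zero) (∣s∣≤α a singleton-independent)
  where
  only-zero : ∀ {i : Fin (suc n)} → lookup ⁅ zero ⁆ i ≡ true → i ≡ zero
  only-zero {zero}  _    = refl
  only-zero {suc i} i∈⊥ = contradiction i∈⊥ (∉⊥ i)
  singleton-independent : Independent a ⁅ zero ⁆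
  singleton-independent {i} {j} i∈ j∈ with refl ← only-zero {i} i∈ | refl ← only-zero {j} j∈ = loopless


-- Strong products

==-refl : ∀ {n} (i : Fin n) → (i == i) ≡ true
==-refl i with i ≟ i
... | yes _   = refl
... | no i≢i = contradiction refl i≢i

==-sym : ∀ {n} (i j : Fin n) → (i == j) ≡ (j == i)
==-sym i j = trans (isYes≗does (i ≟ j)) (trans (does-⇔ (mk⇔ sym sym) (i ≟ j) (j ≟ i)) (sym (isYes≗does (j ≟ i))))

does-≟⇒≡ : ∀ {n} {i j : Fin n} → does (i ≟ j) ≡ true → i ≡ j
does-≟⇒≡ {i = i} {j} eq with i ≟ j
... | yes i≡j = i≡j

EqOrAdj : ∀ {n} → Adj n → Fin n → Fin n → Set
EqOrAdj a i j = i ≡ j ⊎ a i j ≡ true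

eqOrAdj⁻ : ∀ {n} (a : Adj n) {i j} → ((i == j) ∨ a i j) ≡ true → EqOrAdj a i j
eqOrAdj⁻ a {i} {j} h with i ≟ j
... | yes i≡j = inj₁ i≡j
... | no _    = inj₂ h

eqOrAdj⁺ : ∀ {n} (a : Adj n) {i j} → EqOrAdj a i j → ((i == j) ∨ a i j) ≡ true
eqOrAdj⁺ a {i} (inj₁ refl) rewrite ==-refl i = refl
eqOrAdj⁺ a     (inj₂ aij)  rewrite aij       = ∨-zeroʳ _

strong-combine : ∀ {m k} (a : Adj m) (b : Adj k) i j i' j' →
  strong a b (combine i j) (combine i' j')
    ≡ not (combine i j == combine i' j') ∧ ((i == i') ∨ a i i') ∧ ((j == j') ∨ b j j')
strong-combine {m} {k} a b i j i' j' = cong₂ adjacency (remQuot-combine i j) (remQuot-combine i' j')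
  where
  adjacency : Fin m × Fin k → Fin m × Fin k → Bool
  adjacency (p , q) (p' , q') = not (combine i j == combine i' j') ∧ ((p == p') ∨ a p p') ∧ ((q == q') ∨ b q q')

strong-combine⁻ : ∀ {m k} (a : Adj m) (b : Adj k) {i j i' j'} → strong a b (combine i j) (combine i' j') ≡ true →
  EqOrAdj a i i' × EqOrAdj b j j' × ¬ (i ≡ i' × j ≡ j')
strong-combine⁻ a b {i} {j} {i'} {j'} adjacent rewrite strong-combine a b i j i' j'
  with combine i j ≟ combine i' j' | (i == i') ∨ a i i' in eqOrAdjᵃ | (j == j') ∨ b j j' in eqOrAdjᵇ
... | no distinct | true | true = eqOrAdj⁻ a eqOrAdjᵃ , eqOrAdj⁻ b eqOrAdjᵇ , λ { (refl , refl) → distinct refl }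

strong-combine⁺ : ∀ {m k} (a : Adj m) (b : Adj k) {i j i' j'} →
  EqOrAdj a i i' → EqOrAdj b j j' → ¬ (i ≡ i' × j ≡ j') → strong a b (combine i j) (combine i' j') ≡ true
strong-combine⁺ a b {i} {j} {i'} {j'} i~i' j~j' distinct
  rewrite strong-combine a b i j i' j' | eqOrAdj⁺ a i~i' | eqOrAdj⁺ b j~j' with combine i j ≟ combine i' j'
... | yes same = contradiction (combine-injective i j i' j' same) distinct
... | no _     = refl

compl-adjacent : ∀ {n} (a : Adj n) {u v} → a u v ≡ false → u ≢ v → compl a u v ≡ true
compl-adjacent a {u} {v} nonadjacent u≢v rewrite nonadjacent with u ≟ v
... | yes u≡v = contradiction u≡v u≢v
... | no _    = refl

complement : ∀ {n} → Graph n → Graph n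
complement X = record
  { adj    = compl (adj X)
  ; sym    = λ i j → cong₂ (λ u v → not u ∧ not v) (Graph.sym X i j) (==-sym i j)
  ; irrefl = λ i → trans (cong (λ u → not (adj X i i) ∧ not u) (==-refl i)) (∧-zeroʳ _)
  }

count : ∀ {n} → (Fin n → Bool) → ℕ
count {n} P = ∑[ i < n ] 𝟙 (P i)

StrongIndependent : ∀ {m k} → Adj m → Adj k → (Fin m → Fin k → Bool) → Set
StrongIndependent a b P =
  ∀ {i j i' j'} → P i j ≡ true → P i' j' ≡ true → EqOrAdj a i i' → EqOrAdj b j j' → i ≡ i' × j ≡ j'

size² : ∀ {m k} → (Fin m → Fin k → Bool) → ℕ
size² {m} {k} P = ∑[ i < m ] count (P i)

size²-× : ∀ {m k} (P : Fin m → Bool) (R : Fin k → Bool) → size² (λ i j → P i ∧ R j) ≡ count P * count R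
size²-× P R =
  sym (trans (∑-*-∑ (𝟙 ∘ P) (𝟙 ∘ R)) (sum-cong-≗ λ i → sum-cong-≗ λ j → sym (𝟙-∧ (P i) (R j))))

flatten : ∀ {m k} → (Fin m → Fin k → Bool) → Subset (m * k)
flatten {m} {k} P = tabulate (uncurry P ∘ remQuot k)

lookup-flatten : ∀ {m k} (P : Fin m → Fin k → Bool) i j → lookup (flatten P) (combine i j) ≡ P i j
lookup-flatten {m} {k} P i j =
  trans (lookup∘tabulate (uncurry P ∘ remQuot k) (combine i j)) (cong (uncurry P) (remQuot-combine i j))

∣s∣≡∑ : ∀ {n} (s : Subset n) → ∣ s ∣ ≡ ∑[ i < n ] 𝟙 (lookup s i)
∣s∣≡∑ []          = refl
∣s∣≡∑ (true ∷ s)  = cong suc (∣s∣≡∑ s)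
∣s∣≡∑ (false ∷ s) = ∣s∣≡∑ s

∣s∣≡size² : ∀ {m k} (s : Subset (m * k)) → ∣ s ∣ ≡ size² {m} {k} (λ i j → lookup s (combine i j))
∣s∣≡size² {m} {k} s = trans (∣s∣≡∑ s) (∑-combine m k (𝟙 ∘ lookup s))

independent-combine : ∀ {m k} (c : Adj (m * k)) (s : Subset (m * k)) →
  (∀ {i i' : Fin m} {j j' : Fin k} → lookup s (combine i j) ≡ true → lookup s (combine i' j') ≡ true →
     c (combine i j) (combine i' j') ≡ false) →
  Independent c s
independent-combine {m} {k} c s indep {z} {z'} =
  subst₂ (λ x y → lookup s x ≡ true → lookup s y ≡ true → c x y ≡ false)
    (combine-remQuot {m} k z) (combine-remQuot {m} k z') indep

size²≤α-strong : ∀ {m k} (a : Adj m) (b : Adj k) {P} → StrongIndependent a b P → size² P ≤ α (strong a b)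
size²≤α-strong {m} {k} a b {P} indep =
  subst (_≤ α (strong a b)) size≡
    (∣s∣≤α (strong a b) {flatten P} (independent-combine {m} {k} (strong a b) (flatten P) nonadjacent))
  where
  size≡ : ∣ flatten P ∣ ≡ size² P
  size≡ =
    trans (∣s∣≡size² {m} {k} (flatten P)) (sum-cong-≗ λ i → sum-cong-≗ λ j → cong 𝟙 (lookup-flatten P i j))
  nonadjacent : ∀ {i i' : Fin m} {j j' : Fin k} →
    lookup (flatten P) (combine i j) ≡ true → lookup (flatten P) (combine i' j') ≡ true →
    strong a b (combine i j) (combine i' j') ≡ false
  nonadjacent {i} {i'} {j} {j'} ij∈ i'j'∈ = ¬-not λ adjacent →
    let i~i' , j~j' , distinct = strong-combine⁻ a b adjacent
    in distinct (indep (trans (sym (lookup-flatten P i j)) ij∈) (trans (sym (lookup-flatten P i' j')) i'j'∈) i~i' j~j')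

α-strong-attained : ∀ {m k} (a : Adj m) (b : Adj k) → ∃ λ P → StrongIndependent a b P × size² P ≡ α (strong a b)
α-strong-attained {m} {k} a b with α-attained (strong a b)
... | s , indep , ∣s∣≡α =
  (λ i j → lookup s (combine i j)) , strongIndependent , trans (sym (∣s∣≡size² {m} {k} s)) ∣s∣≡α
  where
  strongIndependent : StrongIndependent a b (λ (i : Fin m) (j : Fin k) → lookup s (combine i j))
  strongIndependent {i} {j} {i'} {j'} ij∈ i'j'∈ i~i' j~j' with (i ≟ i') ×-dec (j ≟ j')
  ... | yes same    = same
  ... | no distinct = contradiction (strong-combine⁺ a b i~i' j~j' distinct) λ adjacent →
    contradiction (trans (sym adjacent) (indep ij∈ i'j'∈)) λ ()

size²≤α-strong-projection : ∀ {n m k} (a : Adj m) (b : Adj k) (Q : Fin n → Fin m → Fin k → Bool) →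
  (∀ {c i j c' i' j'} → Q c i j ≡ true → Q c' i' j' ≡ true → EqOrAdj a i i' → EqOrAdj b j j' →
     c ≡ c' × i ≡ i' × j ≡ j') →
  ∑[ c < n ] size² (Q c) ≤ α (strong a b)
size²≤α-strong-projection {n} {m} {k} a b Q injective =
  subst (_≤ α (strong a b)) size≡ (size²≤α-strong a b image-independent)
  where
  fibre : Fin m → Fin k → ℕ
  fibre i j = ∑[ c < n ] 𝟙 (Q c i j)
  fibre≤1 : ∀ i j → fibre i j ≤ 1
  fibre≤1 i j = ∑-𝟙-≤1 (λ c → Q c i j) λ Qcij Qc'ij → proj₁ (injective Qcij Qc'ij (inj₁ refl) (inj₁ refl))
  image : Fin m → Fin k → Bool
  image i j = 0 <ᵇ fibre i j
  preimage : ∀ {i j} → image i j ≡ true → ∃ λ c → Q c i j ≡ true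
  preimage {i} {j} hit = ∑-𝟙-witness (λ c → Q c i j) (<ᵇ⇒< 0 (fibre i j) (subst T (sym hit) _))
  image-independent : StrongIndependent a b image
  image-independent ij∈ i'j'∈ i~i' j~j' with preimage ij∈ | preimage i'j'∈
  ... | _ , Qcij | _ , Qc'i'j' = proj₂ (injective Qcij Qc'i'j' i~i' j~j')
  size≡ : size² image ≡ ∑[ c < n ] size² (Q c)
  size≡ = begin
    ∑[ i < m ] ∑[ j < k ] 𝟙 (image i j)
      ≡⟨ sum-cong-≗ (λ i → sum-cong-≗ {k} λ j → 𝟙-0<ᵇ (fibre i j) (fibre≤1 i j)) ⟩
    ∑[ i < m ] ∑[ j < k ] fibre i j
      ≡⟨ sum-cong-≗ (λ i → ∑-comm (λ j c → 𝟙 (Q c i j))) ⟩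
    ∑[ i < m ] ∑[ c < n ] ∑[ j < k ] 𝟙 (Q c i j)
      ≡⟨ ∑-comm (λ i c → ∑[ j < k ] 𝟙 (Q c i j)) ⟩
    ∑[ c < n ] size² (Q c)
      ∎
    where open ≡-Reasoning

n≤α-strong-compl : ∀ {n} (a : Adj n) → n ≤ α (strong a (compl a))
n≤α-strong-compl {n} a = subst (_≤ α (strong a (compl a))) size≡n (size²≤α-strong a (compl a) diagonal-independent)
  where
  diagonal : Fin n → Fin n → Bool
  diagonal i j = does (i ≟ j)
  diagonal-independent : StrongIndependent a (compl a) diagonal
  diagonal-independent {i} {j} {i'} {j'} ii ii' i~i' i~i'ᶜ
    with does-≟⇒≡ {i = i} {j} ii | does-≟⇒≡ {i = i'} {j'} ii' | i~i' | i~i'ᶜ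
  ... | refl | refl | inj₁ i≡i' | _          = i≡i' , i≡i'
  ... | refl | refl | inj₂ _    | inj₁ i≡i'  = i≡i' , i≡i'
  ... | refl | refl | inj₂ adj  | inj₂ adjᶜ with () ← trans (sym adjᶜ) (cong (λ x → not x ∧ _) adj)
  size≡n : size² diagonal ≡ n
  size≡n = begin
    ∑[ i < n ] ∑[ j < n ] 𝟙 (does (i ≟ j))       ≡⟨ sum-cong-≗ (∑-𝟙-≟ {n}) ⟩
    ∑[ i < n ] 1                                  ≡⟨ ∑-const n 1 ⟩
    n * 1                                         ≡⟨ *-identityʳ n ⟩
    n                                             ∎
    where open ≡-Reasoning

α-strong-swap : ∀ {m k} (a : Adj m) (b : Adj k) → α (strong b a) ≤ α (strong a b)
α-strong-swap {m} {k} a b with α-strong-attained b a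
... | P , indep , size≡α = subst (_≤ α (strong a b)) (trans (∑-comm (λ i j → 𝟙 (P j i))) size≡α)
  (size²≤α-strong a b {flip P} λ Pji Pj'i' i~i' j~j' → swap (indep Pji Pj'i' j~j' i~i'))

α-strong-antimono : ∀ {m k} {a a′ : Adj m} (b : Adj k) → (∀ i j → a i j ≡ true → a′ i j ≡ true) →
  α (strong a′ b) ≤ α (strong a b)
α-strong-antimono {a = a} {a′} b a⊆a′ with α-strong-attained a′ b
... | P , indep , size≡α =
  subst (_≤ α (strong a b)) size≡α (size²≤α-strong a b λ Pij Pi'j' i~i' → indep Pij Pi'j' (widen i~i'))
  where
  widen : ∀ {i i'} → EqOrAdj a i i' → EqOrAdj a′ i i'
  widen (inj₁ i≡i') = inj₁ i≡i'
  widen (inj₂ adj)  = inj₂ (a⊆a′ _ _ adj)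

complement-lower-bound : ∀ {n k} (X : Graph n) (H : Graph k) →
  n * α (strong (adj H) (compl (adj X))) ≤ α (strong (adj X) (compl (adj X))) * α (strong (compl (adj X)) (adj H))
complement-lower-bound X H = *-mono-≤ (n≤α-strong-compl (adj X)) (α-strong-swap (compl (adj X)) (adj H))


-- Averaging over self-embeddings

funToFin-cong : ∀ {m n} {f g : Fin m → Fin n} → f ≗ g → funToFin f ≡ funToFin g
funToFin-cong {zero}  f≗g = refl
funToFin-cong {suc m} f≗g = cong₂ combine (f≗g zero) (funToFin-cong (f≗g ∘ suc))

postcompose : ∀ {n} → (Fin n → Fin n) → Fin (n ^ n) → Fin (n ^ n)
postcompose {n} τ i = funToFin (τ ∘ finToFun {n} {n} i)

finToFun-postcompose : ∀ {n} (τ : Fin n → Fin n) i → finToFun (postcompose τ i) ≗ τ ∘ finToFun {n} i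
finToFun-postcompose {n} τ i = finToFun-funToFin (τ ∘ finToFun {n} {n} i)

postcompose-inverse : ∀ {n} {τ τ′ : Fin n → Fin n} → τ ∘ τ′ ≗ id → postcompose τ ∘ postcompose τ′ ≗ id
postcompose-inverse {n} {τ} {τ′} ττ′ i =
  trans (funToFin-cong {n} {n} λ x → trans (cong τ (finToFun-postcompose τ′ i x)) (ττ′ (finToFun i x)))
        (funToFin-finToFin {n} {n} i)

-- A decidable stand-in for IsAutomorphism: on a finite graph these maps are exactly the automorphisms,
-- and injectivity and preservation of (non-)adjacency are all the averaging argument uses.
IsInducedEmbedding : ∀ {n} → Adj n → (Fin n → Fin n) → Set
IsInducedEmbedding a σ = ∀ x y → a (σ x) (σ y) ≡ a x y × (σ x ≡ σ y → x ≡ y)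

isInducedEmbedding? : ∀ {n} (a : Adj n) σ → Dec (IsInducedEmbedding a σ)
isInducedEmbedding? a σ = all? λ x → all? λ y → (a (σ x) (σ y) Bool.≟ a x y) ×-dec ((σ x ≟ σ y) →-dec (x ≟ y))

isInducedEmbedding-resp-≗ : ∀ {n} (a : Adj n) {σ σ′} → σ ≗ σ′ →
  IsInducedEmbedding a σ → IsInducedEmbedding a σ′
isInducedEmbedding-resp-≗ a σ≗σ′ emb x y =
  trans (sym (cong₂ a (σ≗σ′ x) (σ≗σ′ y))) (proj₁ (emb x y)) ,
  λ eq → proj₂ (emb x y) (trans (σ≗σ′ x) (trans eq (sym (σ≗σ′ y))))

automorphism-injective : ∀ {n} (G : Graph n) {τ} → IsAutomorphism G τ → ∀ {x y} → τ x ≡ τ y → x ≡ y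
automorphism-injective G (τ⁻¹ , τ⁻¹∘τ≗id , _) {x} {y} eq =
  trans (sym (τ⁻¹∘τ≗id x)) (trans (cong τ⁻¹ eq) (τ⁻¹∘τ≗id y))

isInducedEmbedding-∘ : ∀ {n} (G : Graph n) {τ σ} → IsAutomorphism G τ →
  IsInducedEmbedding (adj G) σ ⇔ IsInducedEmbedding (adj G) (τ ∘ σ)
isInducedEmbedding-∘ G {τ} {σ} τ-aut@(_ , _ , _ , τ-preserves) = mk⇔
  (λ emb x y → trans (τ-preserves (σ x) (σ y)) (proj₁ (emb x y)) , proj₂ (emb x y) ∘ automorphism-injective G τ-aut)
  (λ emb x y → trans (sym (τ-preserves (σ x) (σ y))) (proj₁ (emb x y)) , proj₂ (emb x y) ∘ cong τ)

module Averaging {N} (G : Graph N) where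

  toFun : Fin (N ^ N) → Fin N → Fin N
  toFun = finToFun

  embedding? : ∀ i → Dec (IsInducedEmbedding (adj G) (toFun i))
  embedding? i = isInducedEmbedding? (adj G) (toFun i)

  embeds : Fin (N ^ N) → ℕ
  embeds i = 𝟙 (does (embedding? i))

  #embeddings : ℕ
  #embeddings = sum embeds

  #embeddings-mapping : Fin N → Fin N → ℕ
  #embeddings-mapping x y = ∑[ i < N ^ N ] (embeds i * 𝟙 (does (toFun i x ≟ y)))

  1≤#embeddings : 1 ≤ #embeddings
  1≤#embeddings = subst (_≤ #embeddings) identity-embeds (term≤∑ embeds (funToFin {N} {N} id))
    where
    identity-embeds : embeds (funToFin {N} {N} id) ≡ 1
    identity-embeds = cong 𝟙 (dec-true (embedding? (funToFin {N} {N} id))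
      (isInducedEmbedding-resp-≗ (adj G) (λ x → sym (finToFun-funToFin id x)) λ x y → refl , id))

  #embeddings-mapping-uniform : VertexTransitive G → ∀ x y y′ → #embeddings-mapping x y′ ≡ #embeddings-mapping x y
  #embeddings-mapping-uniform transitive x y y′ with transitive y y′
  ... | τ , τ-aut@(τ⁻¹ , τ⁻¹∘τ≗id , τ∘τ⁻¹≗id , _) , τy≡y′ = begin
    #embeddings-mapping x y′
      ≡⟨ ∑-permute (λ i → embeds i * 𝟙 (does (toFun i x ≟ y′))) reindex ⟩
    ∑[ i < N ^ N ] (embeds (postcompose τ i) * 𝟙 (does (toFun (postcompose τ i) x ≟ y′)))
      ≡⟨ sum-cong-≗ {N ^ N} (λ i → cong₂ _*_
           (cong 𝟙 (does-⇔ (embeds⇔ i) (embedding? (postcompose τ i)) (embedding? i)))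
           (cong 𝟙 (does-⇔ (maps⇔ i) (toFun (postcompose τ i) x ≟ y′) (toFun i x ≟ y)))) ⟩
    #embeddings-mapping x y ∎
    where
    open ≡-Reasoning
    reindex : Permutation′ (N ^ N)
    reindex = permutation (postcompose τ) (postcompose τ⁻¹)
      (postcompose-inverse {τ = τ} {τ⁻¹} τ∘τ⁻¹≗id) (postcompose-inverse {τ = τ⁻¹} {τ} τ⁻¹∘τ≗id)
    embeds⇔ : ∀ i → IsInducedEmbedding (adj G) (toFun (postcompose τ i)) ⇔ IsInducedEmbedding (adj G) (toFun i)
    embeds⇔ i = mk⇔
      (Equivalence.from (isInducedEmbedding-∘ G τ-aut) ∘ isInducedEmbedding-resp-≗ (adj G) (finToFun-postcompose τ i))
      (isInducedEmbedding-resp-≗ (adj G) (sym ∘ finToFun-postcompose τ i)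
        ∘ Equivalence.to (isInducedEmbedding-∘ G τ-aut))
    maps⇔ : ∀ i → toFun (postcompose τ i) x ≡ y′ ⇔ toFun i x ≡ y
    maps⇔ i = mk⇔
      (λ eq → automorphism-injective G τ-aut (trans (sym (finToFun-postcompose τ i x)) (trans eq (sym τy≡y′))))
      (λ eq → trans (finToFun-postcompose τ i x) (trans (cong τ eq) τy≡y′))

  ∑-#embeddings-mapping : ∀ x → ∑[ y < N ] #embeddings-mapping x y ≡ #embeddings
  ∑-#embeddings-mapping x = begin
    ∑[ y < N ] ∑[ i < N ^ N ] (embeds i * hit i y)   ≡⟨ ∑-comm (λ y i → embeds i * hit i y) ⟩
    ∑[ i < N ^ N ] ∑[ y < N ] (embeds i * hit i y)   ≡⟨ sum-cong-≗ (sym ∘ λ i → *-distribˡ-sum (embeds i) (hit i)) ⟩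
    ∑[ i < N ^ N ] (embeds i * ∑[ y < N ] hit i y)   ≡⟨ sum-cong-≗ (λ i → cong (embeds i *_) (∑-𝟙-≟ (toFun i x))) ⟩
    ∑[ i < N ^ N ] (embeds i * 1)                    ≡⟨ sum-cong-≗ (λ i → *-identityʳ (embeds i)) ⟩
    #embeddings                                      ∎
    where
    open ≡-Reasoning
    hit : Fin (N ^ N) → Fin N → ℕ
    hit i y = 𝟙 (does (toFun i x ≟ y))

  N*#embeddings-mapping : VertexTransitive G → ∀ x y → N * #embeddings-mapping x y ≡ #embeddings
  N*#embeddings-mapping transitive x y = begin
    N * #embeddings-mapping x y             ≡⟨ sym (∑-const N (#embeddings-mapping x y)) ⟩
    ∑[ y′ < N ] #embeddings-mapping x y     ≡⟨ sum-cong-≗ (sym ∘ #embeddings-mapping-uniform transitive x y) ⟩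
    ∑[ y′ < N ] #embeddings-mapping x y′    ≡⟨ ∑-#embeddings-mapping x ⟩
    #embeddings                             ∎
    where open ≡-Reasoning

  averaging : VertexTransitive G → ∀ x (f : Fin N → ℕ) →
    N * ∑[ i < N ^ N ] (embeds i * f (toFun i x)) ≡ #embeddings * sum f
  averaging transitive x f = begin
    N * ∑[ i < N ^ N ] (embeds i * f (toFun i x))       ≡⟨ cong (N *_) orbit-sum ⟩
    N * ∑[ y < N ] (#embeddings-mapping x y * f y)      ≡⟨ *-distribˡ-sum N (λ y → #embeddings-mapping x y * f y) ⟩
    ∑[ y < N ] (N * (#embeddings-mapping x y * f y))    ≡⟨ sum-cong-≗ {N} (λ y → trans (sym (*-assoc N _ (f y)))
                                                             (cong (_* f y) (N*#embeddings-mapping transitive x y))) ⟩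
    ∑[ y < N ] (#embeddings * f y)                      ≡⟨ sym (*-distribˡ-sum #embeddings f) ⟩
    #embeddings * sum f                                 ∎
    where
    open ≡-Reasoning
    hit : Fin (N ^ N) → Fin N → ℕ
    hit i y = 𝟙 (does (toFun i x ≟ y))
    orbit-sum : ∑[ i < N ^ N ] (embeds i * f (toFun i x)) ≡ ∑[ y < N ] (#embeddings-mapping x y * f y)
    orbit-sum = begin
      ∑[ i < N ^ N ] (embeds i * f (toFun i x))
        ≡⟨ sum-cong-≗ {N ^ N} (λ i → cong (embeds i *_) (sym (∑-δ (toFun i x) f))) ⟩
      ∑[ i < N ^ N ] (embeds i * ∑[ y < N ] (hit i y * f y))
        ≡⟨ ∑-*-∑-comm embeds hit f ⟩
      ∑[ y < N ] (#embeddings-mapping x y * f y)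
        ∎

matches-injective : ∀ {N M K} (g : Adj N) (w : Adj M) (h : Adj K) {σ S I} →
  IsInducedEmbedding g σ → StrongIndependent g w S → StrongIndependent (compl g) h I →
  ∀ {a y x a' y' x'} → I (σ a) y ∧ S a x ≡ true → I (σ a') y' ∧ S a' x' ≡ true →
  EqOrAdj h y y' → EqOrAdj w x x' → a ≡ a' × y ≡ y' × x ≡ x'
matches-injective g w h {σ} {S} {I} emb S-ind I-ind {a} {y} {x} {a'} {y'} {x'} ISayx ISa'y'x' y~y' x~x'
  with ∧-true {I (σ a) y} ISayx | ∧-true {I (σ a') y'} ISa'y'x'
... | Iy , Sx | Iy' , Sx' with a ≟ a'
...   | yes refl = refl , proj₂ (I-ind Iy Iy' (inj₁ refl) y~y') , proj₂ (S-ind Sx Sx' (inj₁ refl) x~x')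
...   | no a≢a'  = contradiction same-vertex a≢a'
  where
  same-vertex : a ≡ a'
  same-vertex with g a a' in adjacent
  ... | true  = proj₁ (S-ind Sx Sx' (inj₂ adjacent) x~x')
  ... | false = proj₂ (emb a a') (proj₁ (I-ind Iy Iy' (inj₂ images-adjacentᶜ) y~y'))
    where
    images-adjacentᶜ : compl g (σ a) (σ a') ≡ true
    images-adjacentᶜ = compl-adjacent g (trans (proj₁ (emb a a')) adjacent) (a≢a' ∘ proj₂ (emb a a'))

α-strong-product-bound : ∀ {N M K} (G : Graph N) (w : Adj M) (h : Adj K) → VertexTransitive G →
  α (strong (adj G) w) * α (strong (compl (adj G)) h) ≤ N * α (strong h w)
α-strong-product-bound {N} G w h transitive with α-strong-attained (adj G) w | α-strong-attained (compl (adj G)) h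
... | S , S-ind , ∣S∣≡α | I , I-ind , ∣I∣≡α =
  *-cancelˡ-≤ #embeddings {{>-nonZero 1≤#embeddings}} (begin
    #embeddings * (α (strong (adj G) w) * α (strong (compl (adj G)) h))
      ≡⟨ cong₂ (λ s i → #embeddings * (s * i)) (sym ∣S∣≡α) (sym ∣I∣≡α) ⟩
    #embeddings * (size² S * size² I)   ≡⟨ sym N*total≡ ⟩
    N * total                           ≤⟨ *-monoʳ-≤ N total≤ ⟩
    N * (#embeddings * αhw)             ≡⟨ x∙yz≈y∙xz N #embeddings αhw ⟩
    #embeddings * (N * αhw)             ∎)
  where
  open ≤-Reasoning
  open Averaging G
  αhw : ℕ
  αhw = α (strong h w)
  matches : Fin (N ^ N) → ℕ
  matches i = ∑[ a < N ] (count (I (toFun i a)) * count (S a))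
  total : ℕ
  total = ∑[ i < N ^ N ] (embeds i * matches i)
  matches≤ : ∀ i → IsInducedEmbedding (adj G) (toFun i) → matches i ≤ αhw
  matches≤ i emb = subst (_≤ αhw) (sum-cong-≗ {N} λ a → size²-× (I (toFun i a)) (S a))
    (size²≤α-strong-projection h w (λ a y x → I (toFun i a) y ∧ S a x) (matches-injective (adj G) w h emb S-ind I-ind))
  total≤ : total ≤ #embeddings * αhw
  total≤ = ≤-trans (∑-mono-≤ λ i → 𝟙-does-*-≤ (embedding? i) (matches≤ i))
                   (≤-reflexive (sym (*-distribʳ-sum αhw embeds)))
  N*total≡ : N * total ≡ #embeddings * (size² S * size² I)
  N*total≡ = begin-equality
    N * total
      ≡⟨ cong (N *_) (∑-*-∑-comm embeds (λ i a → count (I (toFun i a))) (count ∘ S)) ⟩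
    N * ∑[ a < N ] (∑[ i < N ^ N ] (embeds i * count (I (toFun i a))) * count (S a))
      ≡⟨ *-distribˡ-sum N (λ a → ∑[ i < N ^ N ] (embeds i * count (I (toFun i a))) * count (S a)) ⟩
    ∑[ a < N ] (N * (∑[ i < N ^ N ] (embeds i * count (I (toFun i a))) * count (S a)))
      ≡⟨ sum-cong-≗ {N} (λ a → trans (sym (*-assoc N _ _))
                                     (cong (_* count (S a)) (averaging transitive a (count ∘ I)))) ⟩
    ∑[ a < N ] (#embeddings * size² I * count (S a))
      ≡⟨ sym (*-distribˡ-sum (#embeddings * size² I) (count ∘ S)) ⟩
    #embeddings * size² I * size² S
      ≡⟨ trans (*-assoc #embeddings _ _) (cong (#embeddings *_) (*-comm (size² I) (size² S))) ⟩
    #embeddings * (size² S * size² I) ∎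


-- α*

toℚᵘ-ratio : ∀ a b → toℚᵘ (ratio a (suc b)) ≃ mkℚᵘ (ℤ.+ a) b
toℚᵘ-ratio a b = toℚᵘ-fromℚᵘ (mkℚᵘ (ℤ.+ a) b)

ratio-≤ : ∀ {a b c d} → 1 ≤ b → 1 ≤ d → a * d ≤ c * b → ratio a b ≤ℚ ratio c d
ratio-≤ {a} {suc b} {c} {suc d} _ _ ad≤cb = toℚᵘ-cancel-≤
  (≤-respˡ-≃ (≃-sym (toℚᵘ-ratio a b)) (≤-respʳ-≃ (≃-sym (toℚᵘ-ratio c d))
    (*≤* (subst₂ ℤ._≤_ (pos-* a (suc d)) (pos-* c (suc b)) (ℤ.+≤+ ad≤cb)))))

isAlphaStar-intro : ∀ {n k} (A : Graph n) (B : Graph (suc k)) {p q} → 1 ≤ q →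
  (∀ m (W : Graph (suc m)) → α (strong (adj A) (adj W)) * q ≤ p * α (strong (adj B) (adj W))) →
  (∃[ m ] Σ (Graph (suc m)) λ W → p * α (strong (adj B) (adj W)) ≤ α (strong (adj A) (adj W)) * q) →
  IsAlphaStar A B (ratio p q)
isAlphaStar-intro A B 1≤q upper (m , W , lower) =
  (λ m W → ratio-≤ (1≤α (strong (adj B) (adj W)) refl) 1≤q (upper m W)) ,
  (λ r r<p/q → m , W , <-≤-trans r<p/q (ratio-≤ 1≤q (1≤α (strong (adj B) (adj W)) refl) lower))

proposition1 : ∀ {n k} (G T : Graph (suc n)) (H : Graph (suc k)) →
    VertexTransitive G → Supergraph T G →
    α (strong (compl (adj T)) (adj H)) ≡ α (strong (compl (adj G)) (adj H)) →
    IsAlphaStar T H (ratio (suc n) (α (strong (compl (adj T)) (adj H))))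
      × IsAlphaStar G H (ratio (suc n) (α (strong (compl (adj T)) (adj H))))
proposition1 {n} G T H transitive T⊇G αᵀ≡αᴳ =
  isAlphaStar-intro T H 1≤αᵀ upperᵀ (n , complement T , complement-lower-bound T H) ,
  isAlphaStar-intro G H 1≤αᵀ upperᴳ (n , complement G , lowerᴳ)
  where
  αᵀ : ℕ
  αᵀ = α (strong (compl (adj T)) (adj H))
  1≤αᵀ : 1 ≤ αᵀ
  1≤αᵀ = 1≤α (strong (compl (adj T)) (adj H)) refl
  upperᴳ : ∀ m (W : Graph (suc m)) → α (strong (adj G) (adj W)) * αᵀ ≤ suc n * α (strong (adj H) (adj W))
  upperᴳ m W = subst (λ αᴳ → α (strong (adj G) (adj W)) * αᴳ ≤ _) (sym αᵀ≡αᴳ)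
    (α-strong-product-bound G (adj W) (adj H) transitive)
  upperᵀ : ∀ m (W : Graph (suc m)) → α (strong (adj T) (adj W)) * αᵀ ≤ suc n * α (strong (adj H) (adj W))
  upperᵀ m W = ≤-trans (*-monoˡ-≤ αᵀ (α-strong-antimono (adj W) T⊇G)) (upperᴳ m W)
  lowerᴳ : suc n * α (strong (adj H) (compl (adj G))) ≤ α (strong (adj G) (compl (adj G))) * αᵀ
  lowerᴳ = subst (λ αᴳ → _ ≤ α (strong (adj G) (compl (adj G))) * αᴳ) (sym αᵀ≡αᴳ)
    (complement-lower-bound G H)
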